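{- For any $k\in\mathbb{N}$ and any $a,b\in[k]$, $$\frac{\Phi(a,b)}{k(a+b)} \leq 1 - \frac{\sqrt{2}}{2},$$ where $\Phi(a,b) = \max_{A,B\subseteq[k],\ |A|=a,\ |B|=b} \left|\{(i,j)\in A\times B : i<j\}\right|$.
   Context: $[k]=\{1,\dots,k\}$. -}

module Defs where

open import Data.Nat using (ℕ; zero; suc; _+_; _*_; _∸_; _⊔_; _<ᵇ_; _≡ᵇ_)
open import Data.Bool using (Bool; true; false; _∧_; if_then_else_)
open import Data.Fin using (Fin; toℕ)
open import Data.Fin.Subset using (Subset; Side; inside; outside; ∣_∣)
open import Data.Vec using (Vec; []; _∷_; lookup)
open import Data.List using (List; []; _∷_; map; concatMap; foldr; allFin; filterᵇ; cartesianProduct)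
open import Data.Product using (_×_; _,_)
open import Data.Nat.ListAction using (sum)

allSubsets : (n : ℕ) → List (Subset n)
allSubsets zero = [] ∷ []
allSubsets (suc n) = concatMap (λ s → (inside ∷ s) ∷ (outside ∷ s) ∷ []) (allSubsets n)

isIn : ∀ {n} → Subset n → Fin n → Bool
isIn A i with lookup A i
... | inside = true
... | outside = false

pairCount : ∀ {n} → Subset n → Subset n → ℕ
pairCount {n} A B =
  sum (map (λ i → sum (map (λ j → if isIn A i ∧ isIn B j ∧ (toℕ i <ᵇ toℕ j) then 1 else 0)
                           (allFin n)))
           (allFin n))

subsetsOfSize : (k a : ℕ) → List (Subset k)
subsetsOfSize k a = filterᵇ (λ A → ∣ A ∣ ≡ᵇ a) (allSubsets k)

-- Φ(a,b) for ground set [k]: maximum of pairCount over |A| = a, |B| = b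
-- (max of the empty list is 0; irrelevant when a, b ≤ k)
Φ : (k a b : ℕ) → ℕ
Φ k a b = foldr _⊔_ 0
  (map (λ { (A , B) → pairCount A B }) (cartesianProduct (subsetsOfSize k a) (subsetsOfSize k b)))

-- Let t = max(0, a + b − k), the least possible size of A ∩ B. Adding one
-- point of [k] at a time shows 2 |{(i,j) ∈ A × B : i < j}| + t² ≤ 2ab, and
-- with 4ab ≤ (a + b)² this leaves D = k(a+b) − Φ(a,b) with
-- 4D ≥ 4k(a+b) − (a+b)² + 2t². If a + b ≤ k this gives 4D ≥ 3k(a+b), and
-- otherwise 4D ≥ (a+b)² + 2k² ≥ 2√2 k(a+b) by AM–GM; either way
-- 2D² ≥ (k(a+b))².
module Submission where

open import Defs
open import Data.Nat using (ℕ; _+_; _*_; _∸_; _≤_)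
open import Data.Product using (_×_)

open import Data.Nat using (zero; suc; _⊔_; _<ᵇ_; _≡ᵇ_; z≤n)
open import Data.Nat.Properties
open import Data.Nat.ListAction using (sum)
open import Data.Nat.Tactic.RingSolver using (solve-∀)
open import Data.Bool using (_∧_; if_then_else_)
open import Data.Bool.Properties using (∧-zeroʳ; ∧-identityʳ; T?)
open import Data.Fin using (Fin; toℕ)
open import Data.Fin.Subset using (Subset; inside; outside; ∣_∣)
open import Data.Fin.Subset.Properties using (∣p∣≤n)
open import Data.Vec using (_∷_; []; lookup)
open import Data.List using (map; allFin)
open import Data.List.Properties using (map-cong; map-tabulate; foldr-preservesᵇ)
open import Data.List.Membership.Propositional using (_∈_)
open import Data.List.Membership.Propositional.Properties using (∈-filter⁻)
open import Data.List.Relation.Unary.All.Properties using (map⁺; cartesianProduct⁺)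
open import Data.Product using (_,_; proj₂)
open import Data.Sum using (inj₁; inj₂)
open import Function using (_∘_; id)
open import Relation.Binary.PropositionalEquality

sumFin : ∀ {n} → (Fin n → ℕ) → ℕ
sumFin {n} f = sum (map f (allFin n))

sumFin-suc : ∀ {n} (f : Fin (suc n) → ℕ) → sumFin f ≡ f Fin.zero + sumFin (f ∘ Fin.suc)
sumFin-suc {n} f = cong (λ xs → f Fin.zero + sum xs)
  (trans (map-tabulate Fin.suc f) (sym (map-tabulate id (f ∘ Fin.suc))))

sumFin-cong : ∀ {n} {f g : Fin n → ℕ} → (∀ i → f i ≡ g i) → sumFin f ≡ sumFin g
sumFin-cong {n} f≗g = cong sum (map-cong f≗g (allFin n))

sumFin-zero : ∀ n → sumFin {n} (λ _ → 0) ≡ 0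
sumFin-zero zero    = refl
sumFin-zero (suc n) = trans (sumFin-suc {n} (λ _ → 0)) (sumFin-zero n)

∣p∣≡sumFin : ∀ {n} (p : Subset n) → ∣ p ∣ ≡ sumFin (λ j → if lookup p j then 1 else 0)
∣p∣≡sumFin []            = refl
∣p∣≡sumFin (inside ∷ p)  =
  trans (cong suc (∣p∣≡sumFin p)) (sym (sumFin-suc (λ j → if lookup (inside ∷ p) j then 1 else 0)))
∣p∣≡sumFin (outside ∷ p) =
  trans (∣p∣≡sumFin p) (sym (sumFin-suc (λ j → if lookup (outside ∷ p) j then 1 else 0)))

isIn≡lookup : ∀ {n} (p : Subset n) i → isIn p i ≡ lookup p i
isIn≡lookup p i with lookup p i
... | inside  = refl
... | outside = refl

orderedPair : ∀ {n} → Subset n → Subset n → Fin n → Fin n → ℕ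
orderedPair A B i j = if lookup A i ∧ lookup B j ∧ (toℕ i <ᵇ toℕ j) then 1 else 0

pairCount≡sumFin : ∀ {n} (A B : Subset n) → pairCount A B ≡ sumFin (λ i → sumFin (orderedPair A B i))
pairCount≡sumFin A B = sumFin-cong λ i → sumFin-cong λ j →
  cong₂ (λ u v → if u ∧ v ∧ (toℕ i <ᵇ toℕ j) then 1 else 0) (isIn≡lookup A i) (isIn≡lookup B j)

orderedPair-zeroʳ : ∀ {n} x y (A B : Subset n) i → orderedPair (x ∷ A) (y ∷ B) i Fin.zero ≡ 0
orderedPair-zeroʳ x y A B i rewrite ∧-zeroʳ y | ∧-zeroʳ (lookup (x ∷ A) i) = refl

orderedPair-firstRow : ∀ {n} x y (A B : Subset n) →
  sumFin (orderedPair (x ∷ A) (y ∷ B) Fin.zero) ≡ (if x then ∣ B ∣ else 0)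
orderedPair-firstRow {n} x y A B
  rewrite sumFin-suc (orderedPair (x ∷ A) (y ∷ B) Fin.zero) | orderedPair-zeroʳ x y A B Fin.zero
  with x
... | outside = sumFin-zero n
... | inside  = trans (sumFin-cong (λ j → cong (λ c → if c then 1 else 0) (∧-identityʳ (lookup B j))))
                      (sym (∣p∣≡sumFin B))

orderedPair-laterRow : ∀ {n} x y (A B : Subset n) i →
  sumFin (orderedPair (x ∷ A) (y ∷ B) (Fin.suc i)) ≡ sumFin (orderedPair A B i)
orderedPair-laterRow x y A B i = trans (sumFin-suc (orderedPair (x ∷ A) (y ∷ B) (Fin.suc i)))
  (cong (_+ sumFin (orderedPair A B i)) (orderedPair-zeroʳ x y A B (Fin.suc i)))

pairCount-∷ : ∀ {n} x y (A B : Subset n) →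
  pairCount (x ∷ A) (y ∷ B) ≡ (if x then ∣ B ∣ else 0) + pairCount A B
pairCount-∷ x y A B = begin
  pairCount (x ∷ A) (y ∷ B)
    ≡⟨ pairCount≡sumFin (x ∷ A) (y ∷ B) ⟩
  sumFin (λ i → sumFin (orderedPair (x ∷ A) (y ∷ B) i))
    ≡⟨ sumFin-suc (λ i → sumFin (orderedPair (x ∷ A) (y ∷ B) i)) ⟩
  sumFin (orderedPair (x ∷ A) (y ∷ B) Fin.zero) + sumFin (λ i → sumFin (orderedPair (x ∷ A) (y ∷ B) (Fin.suc i)))
    ≡⟨ cong₂ _+_ (orderedPair-firstRow x y A B) (sumFin-cong (orderedPair-laterRow x y A B)) ⟩
  (if x then ∣ B ∣ else 0) + sumFin (λ i → sumFin (orderedPair A B i))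
    ≡⟨ cong (_ +_) (sym (pairCount≡sumFin A B)) ⟩
  (if x then ∣ B ∣ else 0) + pairCount A B ∎
  where open ≡-Reasoning

PairBound : ℕ → ℕ → ℕ → ℕ → Set
PairBound n a b P = 2 * P + (a + b ∸ n) * (a + b ∸ n) ≤ 2 * (a * b)

a+b∸n≤a : ∀ a {b n} → b ≤ n → a + b ∸ n ≤ a
a+b∸n≤a a {n = n} b≤n = ≤-trans (∸-monoˡ-≤ n (+-monoʳ-≤ a b≤n)) (≤-reflexive (m+n∸n≡m a n))

a+b∸n≤b : ∀ {a} b {n} → a ≤ n → a + b ∸ n ≤ b
a+b∸n≤b {a} b {n} a≤n = subst (_≤ b) (cong (_∸ n) (+-comm b a)) (a+b∸n≤a b a≤n)

suc-∸-≤ : ∀ m n → suc m ∸ n ≤ suc (m ∸ n)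
suc-∸-≤ m       zero    = ≤-refl
suc-∸-≤ zero    (suc n) = ≤-trans (≤-reflexive (0∸n≡0 n)) z≤n
suc-∸-≤ (suc m) (suc n) = suc-∸-≤ m n

PairBound-zero : ∀ {n a b} → a ≤ n → b ≤ n → PairBound n a b 0
PairBound-zero {n} {a} {b} a≤n b≤n =
  ≤-trans (*-mono-≤ (a+b∸n≤a a b≤n) (a+b∸n≤b b a≤n)) (m≤m+n (a * b) (a * b + 0))

PairBound-suc : ∀ {n a b P} → PairBound n a b P → PairBound (suc n) a b P
PairBound-suc {n} {a} {b} {P} bound =
  ≤-trans (+-monoʳ-≤ (2 * P) (*-mono-≤ t′≤t t′≤t)) bound
  where
  t′≤t : a + b ∸ suc n ≤ a + b ∸ n
  t′≤t = ∸-monoʳ-≤ (a + b) (n≤1+n n)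

PairBound-sucʳ : ∀ {n a b P} → PairBound n a b P → PairBound (suc n) a (suc b) P
PairBound-sucʳ {n} {a} {b} {P} bound rewrite +-suc a b =
  ≤-trans bound (*-monoʳ-≤ 2 (*-monoʳ-≤ a (n≤1+n b)))

PairBound-sucˡ : ∀ {n a b P} → PairBound n a b P → PairBound (suc n) (suc a) b (b + P)
PairBound-sucˡ {n} {a} {b} {P} bound = begin
  2 * (b + P) + t * t     ≡⟨ regroup b P (t * t) ⟩
  2 * b + (2 * P + t * t) ≤⟨ +-monoʳ-≤ (2 * b) bound ⟩
  2 * b + 2 * (a * b)     ≡⟨ *-distribˡ-+ 2 b (a * b) ⟨
  2 * (b + a * b)         ∎
  where
  open ≤-Reasoning
  t = a + b ∸ n
  regroup : ∀ b P T → 2 * (b + P) + T ≡ 2 * b + (2 * P + T)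
  regroup = solve-∀

PairBound-suc² : ∀ {n a b P} → b ≤ n → PairBound n a b P → PairBound (suc n) (suc a) (suc b) (b + P)
PairBound-suc² {n} {a} {b} {P} b≤n bound rewrite +-suc a b = begin
  2 * (b + P) + t′ * t′                   ≤⟨ +-monoʳ-≤ (2 * (b + P)) (*-mono-≤ t′≤1+t t′≤1+t) ⟩
  2 * (b + P) + suc t * suc t             ≡⟨ expand b P t ⟩
  (2 * P + t * t) + (2 * b + 2 * t + 1)   ≤⟨ +-mono-≤ bound (+-monoˡ-≤ 1 (+-monoʳ-≤ (2 * b) 2t≤2a)) ⟩
  2 * (a * b) + (2 * b + 2 * a + 1)       ≤⟨ n≤1+n _ ⟩
  suc (2 * (a * b) + (2 * b + 2 * a + 1)) ≡⟨ expand′ a b ⟩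
  2 * (suc a * suc b)                     ∎
  where
  open ≤-Reasoning
  t  = a + b ∸ n
  t′ = suc (a + b) ∸ n
  t′≤1+t : t′ ≤ suc t
  t′≤1+t = suc-∸-≤ (a + b) n
  2t≤2a : 2 * t ≤ 2 * a
  2t≤2a = *-monoʳ-≤ 2 (a+b∸n≤a a b≤n)
  expand : ∀ b P t → 2 * (b + P) + suc t * suc t ≡ (2 * P + t * t) + (2 * b + 2 * t + 1)
  expand = solve-∀
  expand′ : ∀ a b → suc (2 * (a * b) + (2 * b + 2 * a + 1)) ≡ 2 * (suc a * suc b)
  expand′ = solve-∀

pairCount-bound : ∀ {n} (A B : Subset n) → PairBound n ∣ A ∣ ∣ B ∣ (pairCount A B)
pairCount-bound []      []      = z≤n
pairCount-bound {suc n} (x ∷ A) (y ∷ B) =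
  subst (PairBound (suc n) ∣ x ∷ A ∣ ∣ y ∷ B ∣) (sym (pairCount-∷ x y A B))
        (extend x y (pairCount-bound A B))
  where
  extend : ∀ x y → PairBound n ∣ A ∣ ∣ B ∣ (pairCount A B) →
    PairBound (suc n) ∣ x ∷ A ∣ ∣ y ∷ B ∣ ((if x then ∣ B ∣ else 0) + pairCount A B)
  extend outside outside = PairBound-suc  {n} {∣ A ∣} {∣ B ∣} {pairCount A B}
  extend outside inside  = PairBound-sucʳ {n} {∣ A ∣} {∣ B ∣} {pairCount A B}
  extend inside  outside = PairBound-sucˡ {n} {∣ A ∣} {∣ B ∣} {pairCount A B}
  extend inside  inside  = PairBound-suc² {n} {∣ A ∣} {∣ B ∣} {pairCount A B} (∣p∣≤n B)

∈subsetsOfSize⇒∣p∣≡a : ∀ {k a} {p : Subset k} → p ∈ subsetsOfSize k a → ∣ p ∣ ≡ a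
∈subsetsOfSize⇒∣p∣≡a {k} {a} p∈ = ≡ᵇ⇒≡ _ a (proj₂ (∈-filter⁻ (T? ∘ λ p → ∣ p ∣ ≡ᵇ a) {xs = allSubsets k} p∈))

⊔-preserves : ∀ (Q : ℕ → Set) {m n} → Q m → Q n → Q (m ⊔ n)
⊔-preserves Q {m} {n} Qm Qn with ⊔-sel m n
... | inj₁ m⊔n≡m = subst Q (sym m⊔n≡m) Qm
... | inj₂ m⊔n≡n = subst Q (sym m⊔n≡n) Qn

Φ-elim : ∀ (Q : ℕ → Set) {k a b} → Q 0 →
  (∀ (A B : Subset k) → ∣ A ∣ ≡ a → ∣ B ∣ ≡ b → Q (pairCount A B)) → Q (Φ k a b)
Φ-elim Q {k} {a} {b} Q0 QpairCount =
  foldr-preservesᵇ {P = Q} {f = _⊔_} (⊔-preserves Q) Q0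
    (map⁺ (cartesianProduct⁺ (setoid _) (setoid _) (subsetsOfSize k a) (subsetsOfSize k b)
      (λ {A} {B} A∈ B∈ → QpairCount A B (∈subsetsOfSize⇒∣p∣≡a A∈) (∈subsetsOfSize⇒∣p∣≡a B∈))))

4xy≤[x+y]² : ∀ x y → 4 * (x * y) ≤ (x + y) * (x + y)
4xy≤[x+y]² zero    y       = z≤n
4xy≤[x+y]² (suc x) zero    = ≤-trans (≤-reflexive (cong (4 *_) (*-zeroʳ (suc x)))) z≤n
4xy≤[x+y]² (suc x) (suc y) = begin
  4 * (suc x * suc y)                  ≡⟨ expand x y ⟩
  4 * (x * y) + 4 * (x + y + 1)        ≤⟨ +-monoˡ-≤ (4 * (x + y + 1)) (4xy≤[x+y]² x y) ⟩
  (x + y) * (x + y) + 4 * (x + y + 1)  ≡⟨ expand′ x y ⟩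
  (suc x + suc y) * (suc x + suc y)    ∎
  where
  open ≤-Reasoning
  expand : ∀ x y → 4 * (suc x * suc y) ≡ 4 * (x * y) + 4 * (x + y + 1)
  expand = solve-∀
  expand′ : ∀ x y → (x + y) * (x + y) + 4 * (x + y + 1) ≡ (suc x + suc y) * (suc x + suc y)
  expand′ = solve-∀

8m²≤[4d]²⇒m²≤2d² : ∀ m d → 8 * (m * m) ≤ (4 * d) * (4 * d) → m * m ≤ 2 * (d * d)
8m²≤[4d]²⇒m²≤2d² m d h = *-cancelˡ-≤ 8 (≤-trans h (≤-reflexive (regroup d)))
  where
  regroup : ∀ d → (4 * d) * (4 * d) ≡ 8 * (2 * (d * d))
  regroup = solve-∀

3m≤4d⇒m²≤2d² : ∀ m d → 3 * m ≤ 4 * d → m * m ≤ 2 * (d * d)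
3m≤4d⇒m²≤2d² m d h = 8m²≤[4d]²⇒m²≤2d² m d (begin
  8 * (m * m)            ≤⟨ m≤m+n (8 * (m * m)) (m * m) ⟩
  8 * (m * m) + m * m    ≡⟨ nine m ⟩
  (3 * m) * (3 * m)      ≤⟨ *-mono-≤ h h ⟩
  (4 * d) * (4 * d)      ∎)
  where
  open ≤-Reasoning
  nine : ∀ m → 8 * (m * m) + m * m ≡ (3 * m) * (3 * m)
  nine = solve-∀

s²+2k²≤4d⇒[ks]²≤2d² : ∀ k s d → s * s + 2 * (k * k) ≤ 4 * d → (k * s) * (k * s) ≤ 2 * (d * d)
s²+2k²≤4d⇒[ks]²≤2d² k s d h = 8m²≤[4d]²⇒m²≤2d² (k * s) d (begin
  8 * ((k * s) * (k * s))                       ≡⟨ regroup k s ⟩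
  4 * ((s * s) * (2 * (k * k)))                 ≤⟨ 4xy≤[x+y]² (s * s) (2 * (k * k)) ⟩
  (s * s + 2 * (k * k)) * (s * s + 2 * (k * k)) ≤⟨ *-mono-≤ h h ⟩
  (4 * d) * (4 * d)                             ∎)
  where
  open ≤-Reasoning
  regroup : ∀ k s → 8 * ((k * s) * (k * s)) ≡ 4 * ((s * s) * (2 * (k * k)))
  regroup = solve-∀

[ks]²≤2d² : ∀ k s d → 4 * (k * s) + 2 * ((s ∸ k) * (s ∸ k)) ≤ 4 * d + s * s →
  (k * s) * (k * s) ≤ 2 * (d * d)
[ks]²≤2d² k s d h with ≤-total s k
... | inj₁ s≤k = 3m≤4d⇒m²≤2d² (k * s) d 3ks≤4d
  where
  open ≤-Reasoning
  four : ∀ m → 3 * m + m ≡ 4 * m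
  four = solve-∀
  3ks≤4d : 3 * (k * s) ≤ 4 * d
  3ks≤4d = +-cancelʳ-≤ (k * s) (3 * (k * s)) (4 * d) (begin
    3 * (k * s) + k * s                    ≡⟨ four (k * s) ⟩
    4 * (k * s)                            ≤⟨ m≤m+n (4 * (k * s)) (2 * ((s ∸ k) * (s ∸ k))) ⟩
    4 * (k * s) + 2 * ((s ∸ k) * (s ∸ k))  ≤⟨ h ⟩
    4 * d + s * s                          ≤⟨ +-monoʳ-≤ (4 * d) (*-monoˡ-≤ s s≤k) ⟩
    4 * d + k * s                          ∎)
... | inj₂ k≤s with m≤n⇒∃[o]m+o≡n k≤s
...   | t , refl = s²+2k²≤4d⇒[ks]²≤2d² k (k + t) d s²+2k²≤4d
  where
  open ≤-Reasoning
  regroup : ∀ k t → ((k + t) * (k + t) + 2 * (k * k)) + (k + t) * (k + t) ≡ 4 * (k * (k + t)) + 2 * (t * t)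
  regroup = solve-∀
  s²+2k²≤4d : (k + t) * (k + t) + 2 * (k * k) ≤ 4 * d
  s²+2k²≤4d = +-cancelʳ-≤ ((k + t) * (k + t)) _ (4 * d) (begin
    ((k + t) * (k + t) + 2 * (k * k)) + (k + t) * (k + t)  ≡⟨ regroup k t ⟩
    4 * (k * (k + t)) + 2 * (t * t)                        ≡⟨ cong (λ u → 4 * (k * (k + t)) + 2 * (u * u)) (m+n∸m≡n k t) ⟨
    4 * (k * (k + t)) + 2 * ((k + t ∸ k) * (k + t ∸ k))    ≤⟨ h ⟩
    4 * d + (k + t) * (k + t)                              ∎)

PairBound⇒ratio-bound : ∀ {k a b P} → a ≤ k → b ≤ k → PairBound k a b P →
  P ≤ k * (a + b) ×
  (k * (a + b)) * (k * (a + b)) ≤ 2 * ((k * (a + b) ∸ P) * (k * (a + b) ∸ P))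
PairBound⇒ratio-bound {k} {a} {b} {P} a≤k b≤k bound = P≤S , [ks]²≤2d² k s (S ∸ P) 4S+2t²≤4D+s²
  where
  open ≤-Reasoning
  s = a + b
  S = k * s
  t = s ∸ k
  P≤ab : P ≤ a * b
  P≤ab = *-cancelˡ-≤ 2 (≤-trans (m≤m+n (2 * P) (t * t)) bound)
  P≤S : P ≤ S
  P≤S = ≤-trans P≤ab (≤-trans (*-monoˡ-≤ b a≤k) (*-monoʳ-≤ k (m≤n+m b a)))
  regroup : ∀ D P T → 4 * (D + P) + 2 * T ≡ 4 * D + 2 * (2 * P + T)
  regroup = solve-∀
  4S+2t²≤4D+s² : 4 * S + 2 * (t * t) ≤ 4 * (S ∸ P) + s * s
  4S+2t²≤4D+s² = begin
    4 * S + 2 * (t * t)                ≡⟨ cong (λ x → 4 * x + 2 * (t * t)) (m∸n+n≡m P≤S) ⟨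
    4 * (S ∸ P + P) + 2 * (t * t)      ≡⟨ regroup (S ∸ P) P (t * t) ⟩
    4 * (S ∸ P) + 2 * (2 * P + t * t)  ≤⟨ +-monoʳ-≤ (4 * (S ∸ P)) (*-monoʳ-≤ 2 bound) ⟩
    4 * (S ∸ P) + 2 * (2 * (a * b))    ≡⟨ cong (4 * (S ∸ P) +_) (*-assoc 2 2 (a * b)) ⟨
    4 * (S ∸ P) + 4 * (a * b)          ≤⟨ +-monoʳ-≤ (4 * (S ∸ P)) (4xy≤[x+y]² a b) ⟩
    4 * (S ∸ P) + s * s                ∎

lemma3p4 : (k a b : ℕ) → 1 ≤ a → a ≤ k → 1 ≤ b → b ≤ k →
    Φ k a b ≤ k * (a + b) ×
    (k * (a + b)) * (k * (a + b)) ≤ 2 * ((k * (a + b) ∸ Φ k a b) * (k * (a + b) ∸ Φ k a b))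
lemma3p4 k a b _ a≤k _ b≤k = PairBound⇒ratio-bound {k} {a} {b} {Φ k a b} a≤k b≤k Φ-bound
  where
  Φ-bound : PairBound k a b (Φ k a b)
  Φ-bound = Φ-elim (PairBound k a b) {k} {a} {b} (PairBound-zero {k} {a} {b} a≤k b≤k) λ A B ∣A∣≡a ∣B∣≡b →
    subst₂ (λ a′ b′ → PairBound k a′ b′ (pairCount A B)) ∣A∣≡a ∣B∣≡b (pairCount-bound A B)
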